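{- Let $U$ be a skew tableau of shape $\zeta\setminus\eta$ with columns $U_1,\dots,U_k$ (column $i$ occupying rows $\eta_i+1,\dots,\zeta_i$, where $\eta_i=0$ if $i$ exceeds the number of lengths of $\eta$). Let $1\le l\le k$ and $d>0$ be integers. Then there is a sequence of reverse jeu de taquin slides applied to $U$ whose result is the skew tableau obtained from $U$ by moving every entry of each of the columns $U_1,\dots,U_l$ down exactly $d$ rows, with all other entries of $U$ unchanged in position and value.
   Context: Conventions: English notation, rows numbered top to bottom, columns left to right. A shape is a weakly decreasing sequence $\zeta=(\zeta_1\ge\dots\ge\zeta_k)$ of positive integers giving column lengths; its Young diagram has $\zeta_i$ top-justified boxes in column $i$. For a shape $\eta$ with $l'\le k$ lengths and $\eta_i\le\zeta_i$, the skew diagram $\zeta\setminus\eta$ is the Young diagram of $\zeta$ with that of $\eta$ removed. A skew tableau is a filling of a skew diagram with positive integers, strictly increasing down columns and weakly increasing along rows. Reverse jeu de taquin (RJDT) slides are the standard operation (e.g., Fulton, "Young Tableaux", Ch. 1), performed starting at an outside corner of the skew diagram. -}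

module Defs where

open import Data.Nat using (ℕ; zero; suc; _+_; _∸_; _≤_; _<_; pred; _≡ᵇ_; _<ᵇ_)
open import Data.Bool using (if_then_else_; _∧_)
open import Data.List using (List; []; _∷_; length)
open import Data.List.Relation.Unary.All using (All)
open import Data.Product using (Σ; ∃; _×_; _,_)
open import Data.Sum using (_⊎_)
open import Relation.Binary.PropositionalEquality using (_≡_)
open import Relation.Nullary using (¬_)
open import Relation.Binary.Construct.Closure.ReflexiveTransitive using (Star)

-- Conventions: columns and rows are indexed from 0 (column 0 = paper's
-- column 1, row 0 = paper's row 1).  A shape is a list of column lengths.

at : List ℕ → ℕ → ℕ
at []       _       = 0
at (x ∷ xs) zero    = x
at (x ∷ xs) (suc i) = at xs i

IsShape : List ℕ → Set
IsShape ζ = All (λ x → 0 < x) ζ × (∀ i → at ζ (suc i) ≤ at ζ i)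

InDiag : List ℕ → List ℕ → ℕ → ℕ → Set
InDiag ζ η i r = at η i ≤ r × r < at ζ i

-- A filling of a skew diagram: outer shape, inner shape and entries
-- (fill column row); values outside the diagram are irrelevant.
record SkewTab : Set where
  constructor mkTab
  field
    outer : List ℕ
    inner : List ℕ
    fill  : ℕ → ℕ → ℕ
open SkewTab public

IsSkewTableau : SkewTab → Set
IsSkewTableau T =
  IsShape (outer T) × IsShape (inner T)
  × length (inner T) ≤ length (outer T)
  × (∀ i → at (inner T) i ≤ at (outer T) i)
  × (∀ i r → InDiag (outer T) (inner T) i r → 0 < fill T i r)
  × (∀ i r s → InDiag (outer T) (inner T) i r → InDiag (outer T) (inner T) i s
       → r < s → fill T i r < fill T i s)
  × (∀ i j r → InDiag (outer T) (inner T) i r → InDiag (outer T) (inner T) j r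
       → i < j → fill T i r ≤ fill T j r)

_≈T_ : SkewTab → SkewTab → Set
T ≈T T' = outer T ≡ outer T' × inner T ≡ inner T'
  × (∀ i r → InDiag (outer T) (inner T) i r → fill T i r ≡ fill T' i r)

bump : List ℕ → ℕ → List ℕ
bump []       zero    = 1 ∷ []
bump []       (suc i) = 0 ∷ bump [] i
bump (x ∷ xs) zero    = suc x ∷ xs
bump (x ∷ xs) (suc i) = x ∷ bump xs i

-- c is an outside corner of ζ: adding a box at the bottom of column c
-- gives again a shape
OuterCorner : List ℕ → ℕ → Set
OuterCorner ζ c = c ≡ 0 ⊎ ∃ λ c' → c ≡ suc c' × at ζ c < at ζ c'

upd : (ℕ → ℕ → ℕ) → ℕ → ℕ → ℕ → (ℕ → ℕ → ℕ)
upd F c r v = λ i s → if (i ≡ᵇ c) ∧ (s ≡ᵇ r) then v else F i s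

LeftIn : List ℕ → List ℕ → ℕ → ℕ → Set
LeftIn ζ η c r = ∃ λ c' → c ≡ suc c' × InDiag ζ η c' r

-- Running a reverse slide: ζ is the (enlarged) outer shape, η the inner
-- shape, F the current filling and (c , r) the hole.  The larger of the
-- entries above / to the left of the hole slides into it (the one above
-- if they are equal); when neither exists the hole is added to the inner
-- shape and the result is the final tableau.
data RSlideRun (ζ : List ℕ) : List ℕ → (ℕ → ℕ → ℕ) → ℕ → ℕ → SkewTab → Set where
  stop : ∀ {η F c r} → ¬ (at η c < r) → ¬ LeftIn ζ η c r
       → RSlideRun ζ η F c r (mkTab ζ (bump η c) F)
  fromAbove : ∀ {η F c r T} → at η c < r
       → (∀ c' → c ≡ suc c' → InDiag ζ η c' r → F c' r ≤ F c (pred r))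
       → RSlideRun ζ η (upd F c r (F c (pred r))) c (pred r) T
       → RSlideRun ζ η F c r T
  fromLeft : ∀ {η F c' r T} → InDiag ζ η c' r
       → (at η (suc c') < r → F (suc c') (pred r) < F c' r)
       → RSlideRun ζ η (upd F (suc c') r (F c' r)) c' r T
       → RSlideRun ζ η F (suc c') r T

RJDT : SkewTab → SkewTab → Set
RJDT T T' = ∃ λ c → OuterCorner (outer T) c
  × RSlideRun (bump (outer T) c) (inner T) (fill T) c (at (outer T) c) T'

shiftList : ℕ → ℕ → List ℕ → List ℕ
shiftList zero    d xs       = xs
shiftList (suc l) d []       = d ∷ shiftList l d []
shiftList (suc l) d (x ∷ xs) = (x + d) ∷ shiftList l d xs

shiftTab : ℕ → ℕ → SkewTab → SkewTab
shiftTab l d T = mkTab (shiftList l d (outer T)) (shiftList l d (inner T))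
  (λ i r → if i <ᵇ l then fill T i (r ∸ d) else fill T i r)

-- The first l columns are lowered one after the other, from left to right,
-- each by d single-row steps.  To lower column c by one row, start a reverse
-- slide at the outside corner just below it.  The hole then climbs straight up
-- column c: the entry to its left lies in column c − 1, already lowered by d
-- rows, while the entry above it lies in column c, lowered by fewer than d
-- rows, so the column and row monotonicity of U makes the entry above the
-- larger one.  For the same reason the top box of column c has no box of the
-- skew diagram to its left, so the hole leaves the diagram there.
module Submission where

open import Defs
open import Data.Nat using (ℕ; zero; suc; _+_; _∸_; _≤_; _<_; pred; _≡ᵇ_; _<ᵇ_; s≤s)
open import Data.Nat.Properties
open import Data.Bool using (true; false)
open import Data.Bool.Properties using (T-≡; ¬-not; ∧-zeroʳ)
open import Data.List using (List; []; _∷_; length)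
open import Data.Product using (Σ; _×_; _,_)
open import Data.Sum using (inj₁; inj₂)
open import Function.Bundles using (Equivalence)
open import Relation.Nullary using (¬_; contradiction)
open import Relation.Nullary.Reflects using (ofʸ; ofⁿ)
open import Relation.Binary.PropositionalEquality
open import Relation.Binary.Construct.Closure.ReflexiveTransitive using (Star; ε; _◅_; _◅◅_)

bumpⁿ : List ℕ → ℕ → ℕ → List ℕ
bumpⁿ xs c zero    = xs
bumpⁿ xs c (suc j) = bump (bumpⁿ xs c j) c

at-bump : ∀ xs c → at (bump xs c) c ≡ suc (at xs c)
at-bump []       zero    = refl
at-bump []       (suc c) = at-bump [] c
at-bump (x ∷ xs) zero    = refl
at-bump (x ∷ xs) (suc c) = at-bump xs c

at-bump-≢ : ∀ xs {c i} → i ≢ c → at (bump xs c) i ≡ at xs i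
at-bump-≢ []       {zero}  {zero}  i≢c = contradiction refl i≢c
at-bump-≢ []       {zero}  {suc i} _   = refl
at-bump-≢ []       {suc c} {zero}  _   = refl
at-bump-≢ []       {suc c} {suc i} i≢c = at-bump-≢ [] (λ i≡c → i≢c (cong suc i≡c))
at-bump-≢ (x ∷ xs) {zero}  {zero}  i≢c = contradiction refl i≢c
at-bump-≢ (x ∷ xs) {zero}  {suc i} _   = refl
at-bump-≢ (x ∷ xs) {suc c} {zero}  _   = refl
at-bump-≢ (x ∷ xs) {suc c} {suc i} i≢c = at-bump-≢ xs (λ i≡c → i≢c (cong suc i≡c))

at-bumpⁿ : ∀ xs c j → at (bumpⁿ xs c j) c ≡ j + at xs c
at-bumpⁿ xs c zero    = refl
at-bumpⁿ xs c (suc j) = trans (at-bump (bumpⁿ xs c j) c) (cong suc (at-bumpⁿ xs c j))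

at-bumpⁿ-≢ : ∀ xs {c i} j → i ≢ c → at (bumpⁿ xs c j) i ≡ at xs i
at-bumpⁿ-≢ xs zero    i≢c = refl
at-bumpⁿ-≢ xs (suc j) i≢c = trans (at-bump-≢ (bumpⁿ xs _ j) i≢c) (at-bumpⁿ-≢ xs j i≢c)

at-shiftList-< : ∀ l d xs {i} → i < l → at (shiftList l d xs) i ≡ at xs i + d
at-shiftList-< (suc l) d []       {zero}  _         = refl
at-shiftList-< (suc l) d []       {suc i} (s≤s i<l) = at-shiftList-< l d [] i<l
at-shiftList-< (suc l) d (x ∷ xs) {zero}  _         = refl
at-shiftList-< (suc l) d (x ∷ xs) {suc i} (s≤s i<l) = at-shiftList-< l d xs i<l

at-shiftList-≥ : ∀ l d xs {i} → l ≤ i → at (shiftList l d xs) i ≡ at xs i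
at-shiftList-≥ zero    d xs       _         = refl
at-shiftList-≥ (suc l) d []       (s≤s l≤i) = at-shiftList-≥ l d [] l≤i
at-shiftList-≥ (suc l) d (x ∷ xs) (s≤s l≤i) = at-shiftList-≥ l d xs l≤i

bumpⁿ-∷-suc : ∀ y ys c k → bumpⁿ (y ∷ ys) (suc c) k ≡ y ∷ bumpⁿ ys c k
bumpⁿ-∷-suc y ys c zero    = refl
bumpⁿ-∷-suc y ys c (suc k) = cong (λ zs → bump zs (suc c)) (bumpⁿ-∷-suc y ys c k)

bumpⁿ-∷-zero : ∀ x xs k → bumpⁿ (x ∷ xs) 0 k ≡ (k + x) ∷ xs
bumpⁿ-∷-zero x xs zero    = refl
bumpⁿ-∷-zero x xs (suc k) = cong (λ zs → bump zs 0) (bumpⁿ-∷-zero x xs k)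

bumpⁿ-[]-zero : ∀ k → bumpⁿ [] 0 (suc k) ≡ suc k ∷ []
bumpⁿ-[]-zero zero    = refl
bumpⁿ-[]-zero (suc k) = cong (λ zs → bump zs 0) (bumpⁿ-[]-zero k)

-- False for d = 0: shiftList pads a short list with columns of length d.
bumpⁿ-shiftList : ∀ l d xs → 0 < d → bumpⁿ (shiftList l d xs) l d ≡ shiftList (suc l) d xs
bumpⁿ-shiftList zero    d       (x ∷ xs) _   = trans (bumpⁿ-∷-zero x xs d) (cong (_∷ xs) (+-comm d x))
bumpⁿ-shiftList zero    (suc d) []       _   = bumpⁿ-[]-zero d
bumpⁿ-shiftList (suc l) d       (x ∷ xs) 0<d =
  trans (bumpⁿ-∷-suc (x + d) _ l d) (cong ((x + d) ∷_) (bumpⁿ-shiftList l d xs 0<d))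
bumpⁿ-shiftList (suc l) d       []       0<d =
  trans (bumpⁿ-∷-suc d _ l d) (cong (d ∷_) (bumpⁿ-shiftList l d [] 0<d))

inDiag-unbump : ∀ {ζ η c i r} → i ≢ c → InDiag (bump ζ c) (bump η c) i r → InDiag ζ η i r
inDiag-unbump {ζ} {η} i≢c (η≤r , r<ζ) =
  subst (_≤ _) (at-bump-≢ η i≢c) η≤r , subst (_ <_) (at-bump-≢ ζ i≢c) r<ζ

≡ᵇ-refl : ∀ n → (n ≡ᵇ n) ≡ true
≡ᵇ-refl n = Equivalence.to T-≡ (≡⇒≡ᵇ n n refl)

≢⇒≡ᵇ≡false : ∀ {m n} → m ≢ n → (m ≡ᵇ n) ≡ false
≢⇒≡ᵇ≡false {m} {n} m≢n = ¬-not (λ eq → m≢n (≡ᵇ⇒≡ m n (Equivalence.from T-≡ eq)))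

upd-≡ : ∀ F c r v → upd F c r v c r ≡ v
upd-≡ F c r v rewrite ≡ᵇ-refl c | ≡ᵇ-refl r = refl

upd-col-≢ : ∀ F {c r v i s} → i ≢ c → upd F c r v i s ≡ F i s
upd-col-≢ F i≢c rewrite ≢⇒≡ᵇ≡false i≢c = refl

upd-row-≢ : ∀ F {c r v i s} → s ≢ r → upd F c r v i s ≡ F i s
upd-row-≢ F {c = c} {i = i} s≢r rewrite ≢⇒≡ᵇ≡false s≢r | ∧-zeroʳ (i ≡ᵇ c) = refl

-- The side condition of fromAbove for a hole at row s of column c.
AboveWins : List ℕ → List ℕ → (ℕ → ℕ → ℕ) → ℕ → ℕ → Set
AboveWins ζ η F c s = ∀ c′ → c ≡ suc c′ → InDiag ζ η c′ s → F c′ s ≤ F c (pred s)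

record ColumnLowered (F G : ℕ → ℕ → ℕ) (c b t : ℕ) : Set where
  field
    other-column : ∀ i s → i ≢ c → G i s ≡ F i s
    lowered      : ∀ s → b < s → s ≤ t → G c s ≡ F c (pred s)
    untouched    : ∀ s → t < s → G c s ≡ F c s

columnLowered-refl : ∀ {F c b} → ColumnLowered F F c b b
columnLowered-refl = record
  { other-column = λ _ _ _ → refl
  ; lowered      = λ _ b<s s≤b → contradiction s≤b (<⇒≱ b<s)
  ; untouched    = λ _ _ → refl
  }

columnLowered-upd : ∀ {F G c b t} → b ≤ t
  → ColumnLowered (upd F c (suc t) (F c t)) G c b t → ColumnLowered F G c b (suc t)
columnLowered-upd {F} {G} {c} {b} {t} b≤t L = record
  { other-column = λ i s i≢c → trans (other-column i s i≢c) (upd-col-≢ F i≢c)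
  ; lowered      = lowered′
  ; untouched    = λ s t<s →
      trans (untouched s (<-trans (n<1+n t) t<s)) (upd-row-≢ F (>⇒≢ t<s))
  }
  where
  open ColumnLowered L
  lowered′ : ∀ s → b < s → s ≤ suc t → G c s ≡ F c (pred s)
  lowered′ s b<s s≤t+1 with m≤n⇒m<n∨m≡n s≤t+1
  ... | inj₁ (s≤s s≤t) =
    trans (lowered s b<s s≤t) (upd-row-≢ F (<⇒≢ (s≤s (≤-trans pred[n]≤n s≤t))))
  ... | inj₂ refl = trans (untouched (suc t) ≤-refl) (upd-≡ F c (suc t) (F c t))

aboveWins-upd : ∀ {ζ η F c s t v} → s ≤ t
  → AboveWins ζ η F c s → AboveWins ζ η (upd F c (suc t) v) c s
aboveWins-upd {F = F} s≤t wins c′ c≡1+c′ inDiag =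
  subst₂ _≤_ (sym (upd-col-≢ F (λ c′≡c → 1+n≢n (sym (trans c′≡c c≡1+c′)))))
             (sym (upd-row-≢ F (<⇒≢ (s≤s (≤-trans pred[n]≤n s≤t)))))
             (wins c′ c≡1+c′ inDiag)

slide-up-column : ∀ {ζ η} c t F → at η c ≤ t
  → (∀ s → at η c < s → s ≤ t → AboveWins ζ η F c s)
  → ¬ LeftIn ζ η c (at η c)
  → Σ (ℕ → ℕ → ℕ) λ G → RSlideRun ζ η F c t (mkTab ζ (bump η c) G)
                        × ColumnLowered F G c (at η c) t
slide-up-column {ζ} {η} c t F η≤t wins noLeft with m≤n⇒m<n∨m≡n η≤t
... | inj₂ refl = F , stop (<-irrefl refl) noLeft , columnLowered-refl
... | inj₁ (s≤s {n = t′} η≤t′) =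
  let G , run , L = slide-up-column c t′ (upd F c t (F c t′)) η≤t′
                      (λ s η<s s≤t′ → aboveWins-upd {ζ} {η} {F} s≤t′ (wins s η<s (m≤n⇒m≤1+n s≤t′)))
                      noLeft
  in G , fromAbove (s≤s η≤t′) (wins t (s≤s η≤t′) ≤-refl) run , columnLowered-upd η≤t′ L

module TableauProperties {T : SkewTab} (isT : IsSkewTableau T) where

  private
    ζ = outer T
    η = inner T

  outer-antitone : ∀ i → at ζ (suc i) ≤ at ζ i
  outer-antitone = let ((_ , antitone) , _) = isT in antitone

  inner-antitone : ∀ i → at η (suc i) ≤ at η i
  inner-antitone = let (_ , (_ , antitone) , _) = isT in antitone

  inner≤outer : ∀ i → at η i ≤ at ζ i
  inner≤outer = let (_ , _ , _ , η≤ζ , _) = isT in η≤ζ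

  column-< : ∀ i r s → InDiag ζ η i r → InDiag ζ η i s → r < s → fill T i r < fill T i s
  column-< = let (_ , _ , _ , _ , _ , increasing , _) = isT in increasing

  row-≤ : ∀ i j r → InDiag ζ η i r → InDiag ζ η j r → i < j → fill T i r ≤ fill T j r
  row-≤ = let (_ , _ , _ , _ , _ , _ , nondecreasing) = isT in nondecreasing

  column-≤ : ∀ i r s → InDiag ζ η i r → InDiag ζ η i s → r ≤ s → fill T i r ≤ fill T i s
  column-≤ i r s ir is r≤s with m≤n⇒m<n∨m≡n r≤s
  ... | inj₁ r<s  = <⇒≤ (column-< i r s ir is r<s)
  ... | inj₂ refl = ≤-refl

  fill-≤-right-below : ∀ c r s → at η c ≤ r → r ≤ s → InDiag ζ η (suc c) s
    → fill T c r ≤ fill T (suc c) s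
  fill-≤-right-below c r s η≤r r≤s (η≤s , s<ζ) =
    ≤-trans (column-≤ c r s (η≤r , <-≤-trans (≤-<-trans r≤s s<ζ) (outer-antitone c)) cs r≤s)
            (row-≤ c (suc c) s cs (η≤s , s<ζ) (n<1+n c))
    where
    cs : InDiag ζ η c s
    cs = ≤-trans η≤r r≤s , <-≤-trans s<ζ (outer-antitone c)

module Lowering (U : SkewTab) (isT : IsSkewTableau U) (d : ℕ) (0<d : 0 < d) where

  open TableauProperties isT

  private
    ζ = outer U
    η = inner U
    V = fill U

  partialShift : ℕ → ℕ → List ℕ → List ℕ
  partialShift c j xs = bumpⁿ (shiftList c d xs) c j

  at-partialShift-< : ∀ xs {c} j {i} → i < c → at (partialShift c j xs) i ≡ at xs i + d
  at-partialShift-< xs {c} j i<c =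
    trans (at-bumpⁿ-≢ (shiftList c d xs) j (<⇒≢ i<c)) (at-shiftList-< c d xs i<c)

  at-partialShift-≡ : ∀ xs c j → at (partialShift c j xs) c ≡ at xs c + j
  at-partialShift-≡ xs c j =
    trans (at-bumpⁿ (shiftList c d xs) c j)
          (trans (cong (j +_) (at-shiftList-≥ c d xs ≤-refl)) (+-comm j _))

  at-partialShift-> : ∀ xs {c} j {i} → c < i → at (partialShift c j xs) i ≡ at xs i
  at-partialShift-> xs {c} j c<i =
    trans (at-bumpⁿ-≢ (shiftList c d xs) j (>⇒≢ c<i)) (at-shiftList-≥ c d xs (<⇒≤ c<i))

  record Stage (c j : ℕ) (T : SkewTab) : Set where
    field
      outer-≡ : outer T ≡ partialShift c j ζ
      inner-≡ : inner T ≡ partialShift c j η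
      fill-<  : ∀ i r → InDiag (outer T) (inner T) i r → i < c → fill T i r ≡ V i (r ∸ d)
      fill-≡  : ∀ r → InDiag (outer T) (inner T) c r → fill T c r ≡ V c (r ∸ j)
      fill->  : ∀ i r → InDiag (outer T) (inner T) i r → c < i → fill T i r ≡ V i r

  initial : Stage 0 0 U
  initial = record
    { outer-≡ = refl ; inner-≡ = refl
    ; fill-< = λ _ _ _ () ; fill-≡ = λ _ _ → refl ; fill-> = λ _ _ _ _ → refl }

  outerCorner-partialShift : ∀ c {j} → j < d → OuterCorner (partialShift c j ζ) c
  outerCorner-partialShift zero    _   = inj₁ refl
  outerCorner-partialShift (suc c) {j} j<d = inj₂ (c , refl ,
    subst₂ _<_ (sym (at-partialShift-≡ ζ (suc c) j)) (sym (at-partialShift-< ζ j (n<1+n c)))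
               (+-mono-≤-< (outer-antitone c) j<d))

  no-left-at-top : ∀ {ζ′} c {j} → j < d
    → ¬ LeftIn ζ′ (partialShift c j η) c (at (partialShift c j η) c)
  no-left-at-top zero    _   (_ , () , _)
  no-left-at-top (suc c) {j} j<d (.c , refl , (η≤ , _)) =
    <⇒≱ (<-≤-trans (+-monoʳ-< (at η (suc c)) j<d) (+-monoˡ-≤ d (inner-antitone c)))
        (subst₂ _≤_ (at-partialShift-< η j (n<1+n c)) (at-partialShift-≡ η (suc c) j) η≤)

  above-wins : ∀ c {j F} → j < d
    → Stage c j (mkTab (partialShift c j ζ) (partialShift c j η) F)
    → ∀ s → at (partialShift c j η) c < s → s ≤ at (partialShift c j ζ) c
    → AboveWins (bump (partialShift c j ζ) c) (partialShift c j η) F c s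
  above-wins zero    _ _ _ _ _ _ () _
  above-wins (suc c) {j} {F} j<d st (suc s) (s≤s η≤s) s<ζ .c refl (η≤s+1 , s+1<ζ) = begin
    F c (suc s)               ≡⟨ Stage.fill-< st c (suc s) (η≤s+1 , s+1<ζ′) (n<1+n c) ⟩
    V c (suc s ∸ d)           ≤⟨ fill-≤-right-below c (suc s ∸ d) (s ∸ j) ηc≤ (∸-monoʳ-≤ (suc s) j<d)
                                   (m+n≤o⇒m≤o∸n _ η≤s′ , s∸j<ζ) ⟩
    V (suc c) (s ∸ j)         ≡⟨ sym (Stage.fill-≡ st s (η≤s , s<ζ)) ⟩
    F (suc c) s               ∎
    where
    open ≤-Reasoning
    s+1<ζ′ : suc s < at (partialShift (suc c) j ζ) c
    s+1<ζ′ = subst (suc s <_) (at-bump-≢ (partialShift (suc c) j ζ) (<⇒≢ (n<1+n c))) s+1<ζ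
    ηc≤ : at η c ≤ suc s ∸ d
    ηc≤ = m+n≤o⇒m≤o∸n _ (subst (_≤ suc s) (at-partialShift-< η j (n<1+n c)) η≤s+1)
    η≤s′ : at η (suc c) + j ≤ s
    η≤s′ = subst (_≤ s) (at-partialShift-≡ η (suc c) j) η≤s
    s∸j<ζ : s ∸ j < at ζ (suc c)
    s∸j<ζ = subst (s ∸ j <_) (m+n∸n≡m _ j)
      (∸-monoˡ-< {n = j} (subst (s <_) (at-partialShift-≡ ζ (suc c) j) s<ζ) (m+n≤o⇒n≤o (at η (suc c)) η≤s′))

  lower-once : ∀ c {j T} → j < d → Stage c j T → Σ SkewTab λ T′ → RJDT T T′ × Stage c (suc j) T′
  lower-once c {j} {mkTab _ _ F} j<d st@record { outer-≡ = refl ; inner-≡ = refl } =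
    let G , run , L = slide-up-column c (at ζ′ c) F η′≤ζ′ (above-wins c j<d st) (no-left-at-top {bump ζ′ c} c j<d)
    in mkTab (bump ζ′ c) (bump η′ c) G , (c , outerCorner-partialShift c j<d , run) , stage′ G L
    where
    ζ′ = partialShift c j ζ
    η′ = partialShift c j η
    η′≤ζ′ : at η′ c ≤ at ζ′ c
    η′≤ζ′ = subst₂ _≤_ (sym (at-partialShift-≡ η c j)) (sym (at-partialShift-≡ ζ c j))
                       (+-monoˡ-≤ j (inner≤outer c))
    stage′ : ∀ G → ColumnLowered F G c (at η′ c) (at ζ′ c)
      → Stage c (suc j) (mkTab (bump ζ′ c) (bump η′ c) G)
    stage′ G L = record
      { outer-≡ = refl
      ; inner-≡ = refl
      ; fill-<  = λ i r ir i<c → trans (other-column i r (<⇒≢ i<c))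
                                       (Stage.fill-< st i r (inDiag-unbump {ζ′} {η′} (<⇒≢ i<c) ir) i<c)
      ; fill-≡  = λ r (η<r , r<ζ) → lowered-≡ r (subst (_≤ r) (at-bump η′ c) η<r)
                                                (subst (r <_) (at-bump ζ′ c) r<ζ)
      ; fill->  = λ i r ir c<i → trans (other-column i r (>⇒≢ c<i))
                                       (Stage.fill-> st i r (inDiag-unbump {ζ′} {η′} (>⇒≢ c<i) ir) c<i)
      }
      where
      open ColumnLowered L
      lowered-≡ : ∀ r → at η′ c < r → r < suc (at ζ′ c) → G c r ≡ V c (r ∸ suc j)
      lowered-≡ (suc r) (s≤s η′≤r) (s≤s r<ζ′) =
        trans (lowered (suc r) (s≤s η′≤r) r<ζ′) (Stage.fill-≡ st r (η′≤r , r<ζ′))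

  lower-column : ∀ {c T} → Stage c 0 T → ∀ j → j ≤ d → Σ SkewTab λ W → Star RJDT T W × Stage c j W
  lower-column st zero    _   = _ , ε , st
  lower-column {c} st (suc j) j<d =
    let W  , slides , stW  = lower-column st j (<⇒≤ j<d)
        W′ , slide  , stW′ = lower-once c j<d stW
    in W′ , slides ◅◅ (slide ◅ ε) , stW′

  next-column : ∀ {c W} → Stage c d W → Stage (suc c) 0 W
  next-column {c} {W} st = record
    { outer-≡ = trans outer-≡ (bumpⁿ-shiftList c d ζ 0<d)
    ; inner-≡ = trans inner-≡ (bumpⁿ-shiftList c d η 0<d)
    ; fill-<  = fill-≤
    ; fill-≡  = λ r ir → fill-> (suc c) r ir (n<1+n c)
    ; fill->  = λ i r ir c+1<i → fill-> i r ir (<-trans (n<1+n c) c+1<i)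
    }
    where
    open Stage st
    fill-≤ : ∀ i r → InDiag (outer W) (inner W) i r → i < suc c → fill W i r ≡ V i (r ∸ d)
    fill-≤ i r ir i<c+1 with m<1+n⇒m<n∨m≡n i<c+1
    ... | inj₁ i<c  = fill-< i r ir i<c
    ... | inj₂ refl = fill-≡ r ir

  lower-columns : ∀ c → Σ SkewTab λ W → Star RJDT U W × Stage c 0 W
  lower-columns zero    = U , ε , initial
  lower-columns (suc c) =
    let W  , slides  , stW  = lower-columns c
        W′ , slides′ , stW′ = lower-column stW d ≤-refl
    in W′ , slides ◅◅ slides′ , next-column stW′

  stage⇒≈T-shiftTab : ∀ {l W} → Stage l 0 W → W ≈T shiftTab l d U
  stage⇒≈T-shiftTab {l} {W} st = outer-≡ , inner-≡ , fill-shifted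
    where
    open Stage st
    fill-shifted : ∀ i r → InDiag (outer W) (inner W) i r → fill W i r ≡ fill (shiftTab l d U) i r
    fill-shifted i r ir with i <ᵇ l | <ᵇ-reflects-< i l
    ... | true  | ofʸ i<l = fill-< i r ir i<l
    ... | false | ofⁿ i≮l with m≤n⇒m<n∨m≡n (≮⇒≥ i≮l)
    ...   | inj₁ l<i  = fill-> i r ir l<i
    ...   | inj₂ refl = fill-≡ r ir

lemma3p1 : (U : SkewTab) → IsSkewTableau U → (l d : ℕ)
    → 1 ≤ l → l ≤ length (outer U) → 0 < d
    → Σ SkewTab (λ V → Star RJDT U V × V ≈T shiftTab l d U)
lemma3p1 U isT l d _ _ 0<d =
  let W , slides , stage = lower-columns l in W , slides , stage⇒≈T-shiftTab stage
  where open Lowering U isT d 0<d
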